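{- Fix $r\ge1$. For $n\ge1$ and a colored letter $x=(p,c)$ with $p\in\{1,\dots,n\}$, $c\in\{0,\dots,r-1\}$, let $N(n,x)$ be the number of $r$-colored alternating permutations of size $n$ whose last letter is $x$. Then $N(1,(1,c))=1$ for every color $c$, and for $n\ge2$: if $n$ is even, $N(n,x)=\sum_{y\prec x}N(n-1,y)$; if $n$ is odd, $N(n,x)=\sum_{y\succeq x}N(n-1,y)$; where $y$ ranges over colored letters $(q,d)$ with $q\in\{1,\dots,n-1\}$, $d\in\{0,\dots,r-1\}$.
   Context: Colored letters are pairs $(p,c)$ with $p$ a positive integer and $c\in\{0,\dots,r-1\}$, totally ordered by $(p,c)\prec(q,d)$ iff $c>d$, or $c=d$ and $p<q$ (so all letters of color $0$ are largest, each color class being ordered by value). An $r$-colored permutation of size $n$ is a word $x_1\cdots x_n$ with $x_i=(\sigma_i,u_i)$, where $\sigma\in\mathfrak S_n$ and $u\in\{0,\dots,r-1\}^n$. It is alternating if $x_1\prec x_2\succ x_3\prec x_4\succ\cdots$. -}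

module Defs where

open import Data.Nat using (ℕ; zero; suc; _<ᵇ_; _≡ᵇ_)
open import Data.Bool using (Bool; true; false; _∧_; _∨_; not; if_then_else_)
open import Data.Product using (_×_; _,_; proj₁; proj₂)
open import Data.List using (List; []; _∷_; map; _++_; length; concatMap)

-- A colored letter (p , c): p a positive integer (value), c a color.
Letter : Set
Letter = ℕ × ℕ

_≺ᵇ_ : Letter → Letter → Bool
(p , c) ≺ᵇ (q , d) = (d <ᵇ c) ∨ ((c ≡ᵇ d) ∧ (p <ᵇ q))

_==ᵇ_ : Letter → Letter → Bool
(p , c) ==ᵇ (q , d) = (p ≡ᵇ q) ∧ (c ≡ᵇ d)

_⪰ᵇ_ : Letter → Letter → Bool
y ⪰ᵇ x = (x ≺ᵇ y) ∨ (y ==ᵇ x)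

oneTo : ℕ → List ℕ
oneTo zero = []
oneTo (suc n) = oneTo n ++ (suc n ∷ [])

zeroTo : ℕ → List ℕ
zeroTo zero = []
zeroTo (suc r) = zeroTo r ++ (r ∷ [])

letters : ℕ → ℕ → List Letter
letters n r = concatMap (λ p → map (λ c → (p , c)) (zeroTo r)) (oneTo n)

words : ℕ → List Letter → List (List Letter)
words zero L = [] ∷ []
words (suc k) L = concatMap (λ x → map (x ∷_) (words k L)) L

filterᵇ : {A : Set} → (A → Bool) → List A → List A
filterᵇ f [] = []
filterᵇ f (x ∷ xs) = if f x then x ∷ filterᵇ f xs else filterᵇ f xs

memℕ : ℕ → List ℕ → Bool
memℕ a [] = false
memℕ a (b ∷ bs) = (a ≡ᵇ b) ∨ memℕ a bs

distinct : List ℕ → Bool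
distinct [] = true
distinct (a ∷ as) = not (memℕ a as) ∧ distinct as

-- r-colored permutations of size n: words x₁⋯xₙ with xᵢ = (σᵢ,uᵢ),
-- σᵢ ∈ {1..n}, uᵢ ∈ {0..r-1}, and σ a permutation (values pairwise distinct)
coloredPerms : ℕ → ℕ → List (List Letter)
coloredPerms n r = filterᵇ (λ w → distinct (map proj₁ w)) (words n (letters n r))

altUp altDown : List Letter → Bool
altUp [] = true
altUp (x ∷ []) = true
altUp (x ∷ y ∷ w) = (x ≺ᵇ y) ∧ altDown (y ∷ w)
altDown [] = true
altDown (x ∷ []) = true
altDown (x ∷ y ∷ w) = (y ≺ᵇ x) ∧ altUp (y ∷ w)

isAlternating : List Letter → Bool
isAlternating = altUp

endsWith : Letter → List Letter → Bool
endsWith x [] = false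
endsWith x (y ∷ []) = y ==ᵇ x
endsWith x (y ∷ z ∷ w) = endsWith x (z ∷ w)

N : ℕ → ℕ → Letter → ℕ
N r n x = length (filterᵇ (λ w → isAlternating w ∧ endsWith x w) (coloredPerms n r))

-- Deleting the last letter x = (p , c) of an r-colored permutation of size n and standardizing the
-- remaining values (those above p drop by one) is a bijection onto the r-colored permutations of
-- size n - 1. Its inverse punches the value p back in, which preserves ≺ between the remaining
-- letters, so the long word is alternating exactly when the short one is and the final comparison
-- holds: x_{n-1} ≺ x for n even, x ≺ x_{n-1} for n odd. For the standardized last letter y of the
-- short word these read y ≺ x and y ⪰ x respectively; equality y = x appears because a value equal
-- to p is punched up to p + 1. Summing over y gives the recursion. Formally N is a sum of
-- indicators over all words, and the bijection is a change of summation variable.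

module Submission where

open import Defs
open import Data.Bool using (Bool; true; false; _∧_; _∨_; not; if_then_else_)
open import Data.Bool.Properties
  using (∧-assoc; ∧-comm; ∧-identityʳ; ∧-zeroʳ; ∨-assoc; ∨-zeroʳ; ∧-distribˡ-∨; T-≡)
open import Data.List using (List; []; _∷_; [_]; _++_; _∷ʳ_; map; concatMap; length)
open import Data.Bool.ListAction using (all)
open import Data.List.Properties
  using (map-++; map-∘; map-cong; map-cong-local; map-id-local; length-map;
         concatMap-map; map-concatMap; concatMap-cong; concatMap-++; ++-identityʳ)
open import Data.List.Relation.Unary.All as All using (All; []; _∷_)
open import Data.List.Relation.Unary.All.Properties using (map⁺; concat⁺; ∷ʳ⁺)
open import Data.Nat using (ℕ; zero; suc; _+_; _∸_; _≤_; _<_; _%_; _<ᵇ_; _≡ᵇ_; z≤n; s≤s; s<s)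
open import Data.Nat.ListAction using (sum)
open import Data.Nat.ListAction.Properties using (sum-++)
open import Data.Nat.Properties
  using (+-identityʳ; +-commutativeSemigroup; ≤-refl; ≤-trans; <⇒≤; <⇒≢; ≮⇒≥; <-irrefl; <-asym; ≤⇒≯;
         <-trans; <-cmp; n<1+n; m<n⇒m<1+n; m≤n⇒m≤1+n; m<1+n⇒m<n∨m≡n; ≡ᵇ⇒≡; ≡⇒≡ᵇ; <ᵇ⇒<; <⇒<ᵇ; <ᵇ-reflects-<; _<?_)
open import Data.Product using (_×_; _,_; proj₁; map₁)
open import Data.Sum using (inj₁; inj₂)
open import Data.Empty using (⊥-elim)
open import Function using (_∘_; Equivalence)
open import Relation.Binary using (tri<; tri≈; tri>)
open import Relation.Binary.PropositionalEquality
  using (_≡_; _≢_; _≗_; refl; sym; trans; cong; cong₂; ≢-sym; module ≡-Reasoning)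
open import Relation.Nullary.Decidable using (yes; no)
open import Relation.Nullary.Reflects using (Reflects; ofʸ; ofⁿ; det; fromEquivalence)

open import Algebra.Properties.CommutativeSemigroup +-commutativeSemigroup renaming (interchange to +-interchange)
open ≡-Reasoning

private
  variable
    A B : Set

≡ᵇ-reflects-≡ : ∀ m n → Reflects (m ≡ n) (m ≡ᵇ n)
≡ᵇ-reflects-≡ m n = fromEquivalence (≡ᵇ⇒≡ m n) (≡⇒≡ᵇ m n)

≡ᵇ-true⇒≡ : ∀ m n → (m ≡ᵇ n) ≡ true → m ≡ n
≡ᵇ-true⇒≡ m n h = ≡ᵇ⇒≡ m n (Equivalence.from T-≡ h)

≡ᵇ-refl : ∀ m → (m ≡ᵇ m) ≡ true
≡ᵇ-refl m = det (≡ᵇ-reflects-≡ m m) (ofʸ refl)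

≡ᵇ-false : ∀ {m n} → m ≢ n → (m ≡ᵇ n) ≡ false
≡ᵇ-false m≢n = det (≡ᵇ-reflects-≡ _ _) (ofⁿ m≢n)

≡ᵇ-sym : ∀ m n → (m ≡ᵇ n) ≡ (n ≡ᵇ m)
≡ᵇ-sym m n = det (≡ᵇ-reflects-≡ m n) (fromEquivalence (sym ∘ ≡ᵇ⇒≡ n m) (≡⇒≡ᵇ n m ∘ sym))

<ᵇ-true : ∀ {m n} → m < n → (m <ᵇ n) ≡ true
<ᵇ-true m<n = det (<ᵇ-reflects-< _ _) (ofʸ m<n)

<ᵇ-false : ∀ {m n} → n ≤ m → (m <ᵇ n) ≡ false
<ᵇ-false n≤m = det (<ᵇ-reflects-< _ _) (ofⁿ (≤⇒≯ n≤m))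

-- Finite sums over lists

⟦_⟧ : Bool → ℕ
⟦ true ⟧  = 1
⟦ false ⟧ = 0

⟦∧⟧ : ∀ b c → ⟦ b ∧ c ⟧ ≡ (if c then ⟦ b ⟧ else 0)
⟦∧⟧ true  true  = refl
⟦∧⟧ true  false = refl
⟦∧⟧ false true  = refl
⟦∧⟧ false false = refl

if-swap : ∀ b c (n : ℕ) → (if b then (if c then n else 0) else 0) ≡ (if c then (if b then n else 0) else 0)
if-swap true  c n = refl
if-swap false true  n = refl
if-swap false false n = refl

∑ : List A → (A → ℕ) → ℕ
∑ xs f = sum (map f xs)

syntax ∑ xs (λ x → e) = ∑[ x ∈ xs ] e

∑-cong : ∀ (xs : List A) {f g : A → ℕ} → f ≗ g → ∑ xs f ≡ ∑ xs g
∑-cong xs f≗g = cong sum (map-cong f≗g xs)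

∑-cong-All : ∀ {P : A → Set} {xs f g} → All P xs → (∀ {a} → P a → f a ≡ g a) → ∑ xs f ≡ ∑ xs g
∑-cong-All pxs f≡g = cong sum (map-cong-local (All.map f≡g pxs))

∑-zero : ∀ (xs : List A) → ∑[ x ∈ xs ] 0 ≡ 0
∑-zero []       = refl
∑-zero (x ∷ xs) = ∑-zero xs

∑-++ : ∀ (xs ys : List A) f → ∑ (xs ++ ys) f ≡ ∑ xs f + ∑ ys f
∑-++ xs ys f = trans (cong sum (map-++ f xs ys)) (sum-++ (map f xs) (map f ys))

∑-∷ʳ : ∀ (xs : List A) x f → ∑ (xs ∷ʳ x) f ≡ ∑ xs f + f x
∑-∷ʳ xs x f = trans (∑-++ xs [ x ] f) (cong (∑ xs f +_) (+-identityʳ (f x)))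

∑-map : ∀ (h : A → B) xs f → ∑ (map h xs) f ≡ ∑ xs (f ∘ h)
∑-map h xs f = cong sum (sym (map-∘ xs))

∑-concatMap : ∀ (h : A → List B) xs f → ∑ (concatMap h xs) f ≡ ∑[ x ∈ xs ] ∑ (h x) f
∑-concatMap h []       f = refl
∑-concatMap h (x ∷ xs) f = begin
  ∑ (h x ++ concatMap h xs) f          ≡⟨ ∑-++ (h x) (concatMap h xs) f ⟩
  ∑ (h x) f + ∑ (concatMap h xs) f     ≡⟨ cong (∑ (h x) f +_) (∑-concatMap h xs f) ⟩
  ∑ (h x) f + ∑[ y ∈ xs ] ∑ (h y) f    ∎

∑-+ : ∀ (xs : List A) f g → ∑[ x ∈ xs ] (f x + g x) ≡ ∑ xs f + ∑ xs g
∑-+ []       f g = refl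
∑-+ (x ∷ xs) f g = begin
  (f x + g x) + ∑[ y ∈ xs ] (f y + g y)  ≡⟨ cong ((f x + g x) +_) (∑-+ xs f g) ⟩
  (f x + g x) + (∑ xs f + ∑ xs g)        ≡⟨ +-interchange (f x) (g x) (∑ xs f) (∑ xs g) ⟩
  (f x + ∑ xs f) + (g x + ∑ xs g)        ∎

∑-comm : ∀ (xs : List A) (ys : List B) (f : A → B → ℕ) →
         ∑[ x ∈ xs ] ∑[ y ∈ ys ] f x y ≡ ∑[ y ∈ ys ] ∑[ x ∈ xs ] f x y
∑-comm []       ys f = sym (∑-zero ys)
∑-comm (x ∷ xs) ys f = begin
  ∑ ys (f x) + ∑[ x′ ∈ xs ] ∑[ y ∈ ys ] f x′ y  ≡⟨ cong (∑ ys (f x) +_) (∑-comm xs ys f) ⟩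
  ∑ ys (f x) + ∑[ y ∈ ys ] ∑[ x′ ∈ xs ] f x′ y  ≡⟨ sym (∑-+ ys (f x) (λ y → ∑[ x′ ∈ xs ] f x′ y)) ⟩
  ∑[ y ∈ ys ] (f x y + ∑[ x′ ∈ xs ] f x′ y)     ∎

filterᵇ-++ : ∀ (f : A → Bool) xs ys → filterᵇ f (xs ++ ys) ≡ filterᵇ f xs ++ filterᵇ f ys
filterᵇ-++ f []       ys = refl
filterᵇ-++ f (x ∷ xs) ys with f x
... | true  = cong (x ∷_) (filterᵇ-++ f xs ys)
... | false = filterᵇ-++ f xs ys

filterᵇ-all : ∀ {f : A → Bool} {xs} → All (λ x → f x ≡ true) xs → filterᵇ f xs ≡ xs
filterᵇ-all []                 = refl
filterᵇ-all (fx≡true ∷ fxs) rewrite fx≡true = cong (_ ∷_) (filterᵇ-all fxs)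

filterᵇ-none : ∀ {f : A → Bool} {xs} → All (λ x → f x ≡ false) xs → filterᵇ f xs ≡ []
filterᵇ-none []                  = refl
filterᵇ-none (fx≡false ∷ fxs) rewrite fx≡false = filterᵇ-none fxs

filterᵇ-filterᵇ : ∀ (f g : A → Bool) xs → filterᵇ f (filterᵇ g xs) ≡ filterᵇ (λ x → g x ∧ f x) xs
filterᵇ-filterᵇ f g []       = refl
filterᵇ-filterᵇ f g (x ∷ xs) with g x
... | false = filterᵇ-filterᵇ f g xs
... | true with f x
...   | true  = cong (x ∷_) (filterᵇ-filterᵇ f g xs)
...   | false = filterᵇ-filterᵇ f g xs

∑-filterᵇ : ∀ (c : A → Bool) xs f → ∑ (filterᵇ c xs) f ≡ ∑[ x ∈ xs ] (if c x then f x else 0)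
∑-filterᵇ c []       f = refl
∑-filterᵇ c (x ∷ xs) f with c x
... | true  = cong (f x +_) (∑-filterᵇ c xs f)
... | false = ∑-filterᵇ c xs f

length-filterᵇ : ∀ (f : A → Bool) xs → length (filterᵇ f xs) ≡ ∑[ x ∈ xs ] ⟦ f x ⟧
length-filterᵇ f []       = refl
length-filterᵇ f (x ∷ xs) with f x
... | true  = cong suc (length-filterᵇ f xs)
... | false = length-filterᵇ f xs

InRange : ℕ → ℕ → Letter → Set
InRange n r (p , c) = (1 ≤ p × p ≤ n) × c < r

==ᵇ-sym : ∀ y z → (y ==ᵇ z) ≡ (z ==ᵇ y)
==ᵇ-sym (q , d) (q′ , d′) = cong₂ _∧_ (≡ᵇ-sym q q′) (≡ᵇ-sym d d′)

oneTo≡map-suc-zeroTo : ∀ n → oneTo n ≡ map suc (zeroTo n)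
oneTo≡map-suc-zeroTo zero    = refl
oneTo≡map-suc-zeroTo (suc n) = begin
  oneTo n ∷ʳ suc n                 ≡⟨ cong (_∷ʳ suc n) (oneTo≡map-suc-zeroTo n) ⟩
  map suc (zeroTo n) ∷ʳ suc n      ≡⟨ sym (map-++ suc (zeroTo n) [ n ]) ⟩
  map suc (zeroTo n ∷ʳ n)          ∎

zeroTo-< : ∀ r → All (_< r) (zeroTo r)
zeroTo-< zero    = []
zeroTo-< (suc r) = ∷ʳ⁺ (All.map m<n⇒m<1+n (zeroTo-< r)) (n<1+n r)

oneTo-bounds : ∀ n → All (λ p → 1 ≤ p × p ≤ n) (oneTo n)
oneTo-bounds n rewrite oneTo≡map-suc-zeroTo n = map⁺ (All.map (s≤s z≤n ,_) (zeroTo-< n))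

letters-InRange : ∀ n r → All (InRange n r) (letters n r)
letters-InRange n r =
  concat⁺ (map⁺ (All.map (λ p-bounds → map⁺ (All.map (p-bounds ,_) (zeroTo-< r))) (oneTo-bounds n)))

∑-zeroTo-δ-absent : ∀ {r d} (f : ℕ → ℕ) → r ≤ d → ∑[ c ∈ zeroTo r ] (if c ≡ᵇ d then f c else 0) ≡ 0
∑-zeroTo-δ-absent {zero}      f _     = refl
∑-zeroTo-δ-absent {suc r} {d} f 1+r≤d
  rewrite ∑-∷ʳ (zeroTo r) r (λ c → if c ≡ᵇ d then f c else 0)
        | ∑-zeroTo-δ-absent f (<⇒≤ 1+r≤d) | ≡ᵇ-false (<⇒≢ 1+r≤d) = refl

∑-zeroTo-δ : ∀ {r d} (f : ℕ → ℕ) → d < r → ∑[ c ∈ zeroTo r ] (if c ≡ᵇ d then f c else 0) ≡ f d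
∑-zeroTo-δ {suc r} {d} f d<1+r rewrite ∑-∷ʳ (zeroTo r) r (λ c → if c ≡ᵇ d then f c else 0)
  with m<1+n⇒m<n∨m≡n d<1+r
... | inj₁ d<r  rewrite ∑-zeroTo-δ f d<r | ≡ᵇ-false (≢-sym (<⇒≢ d<r)) = +-identityʳ (f d)
... | inj₂ refl rewrite ∑-zeroTo-δ-absent f (≤-refl {d}) | ≡ᵇ-refl d = refl

∑-oneTo-δ : ∀ {n q} (f : ℕ → ℕ) → 1 ≤ q → q ≤ n → ∑[ p ∈ oneTo n ] (if p ≡ᵇ q then f p else 0) ≡ f q
∑-oneTo-δ {n} {suc q} f _ q<n = begin
  ∑[ p ∈ oneTo n ] (if p ≡ᵇ suc q then f p else 0)           ≡⟨ cong (λ ps → ∑ ps _) (oneTo≡map-suc-zeroTo n) ⟩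
  ∑[ p ∈ map suc (zeroTo n) ] (if p ≡ᵇ suc q then f p else 0) ≡⟨ ∑-map suc (zeroTo n) _ ⟩
  ∑[ c ∈ zeroTo n ] (if c ≡ᵇ q then f (suc c) else 0)         ≡⟨ ∑-zeroTo-δ (f ∘ suc) q<n ⟩
  f (suc q)                                                  ∎

∑-letters-δ : ∀ {n r z} (f : Letter → ℕ) → InRange n r z →
              ∑[ y ∈ letters n r ] (if y ==ᵇ z then f y else 0) ≡ f z
∑-letters-δ {n} {r} {q , d} f ((1≤q , q≤n) , d<r) = begin
  ∑[ y ∈ letters n r ] (if y ==ᵇ (q , d) then f y else 0)
    ≡⟨ ∑-concatMap (λ p → map (p ,_) (zeroTo r)) (oneTo n) _ ⟩
  ∑[ p ∈ oneTo n ] ∑[ y ∈ map (p ,_) (zeroTo r) ] (if y ==ᵇ (q , d) then f y else 0)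
    ≡⟨ ∑-cong (oneTo n) (λ p → trans (∑-map (p ,_) (zeroTo r) _) (row p)) ⟩
  ∑[ p ∈ oneTo n ] (if p ≡ᵇ q then f (p , d) else 0)
    ≡⟨ ∑-oneTo-δ (λ p → f (p , d)) 1≤q q≤n ⟩
  f (q , d) ∎
  where
  row : ∀ p → ∑[ c ∈ zeroTo r ] (if (p ≡ᵇ q) ∧ (c ≡ᵇ d) then f (p , c) else 0)
            ≡ (if p ≡ᵇ q then f (p , d) else 0)
  row p with p ≡ᵇ q
  ... | true  = ∑-zeroTo-δ (λ c → f (p , c)) d<r
  ... | false = ∑-zero (zeroTo r)

-- Punching a value in

module _ {f : ℕ → ℕ} (f-strictMono : ∀ {a b} → a < b → f a < f b) where

  strictMono-injective : ∀ {a b} → f a ≡ f b → a ≡ b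
  strictMono-injective {a} {b} fa≡fb with <-cmp a b
  ... | tri< a<b _ _ = ⊥-elim (<⇒≢ (f-strictMono a<b) fa≡fb)
  ... | tri≈ _ a≡b _ = a≡b
  ... | tri> _ _ b<a = ⊥-elim (<⇒≢ (f-strictMono b<a) (sym fa≡fb))

  strictMono-reflects-< : ∀ {a b} → f a < f b → a < b
  strictMono-reflects-< {a} {b} fa<fb with <-cmp a b
  ... | tri< a<b _ _    = a<b
  ... | tri≈ _ refl _   = ⊥-elim (<-irrefl refl fa<fb)
  ... | tri> _ _ b<a    = ⊥-elim (<-asym fa<fb (f-strictMono b<a))

  strictMono-<ᵇ : ∀ a b → (f a <ᵇ f b) ≡ (a <ᵇ b)
  strictMono-<ᵇ a b = det (<ᵇ-reflects-< (f a) (f b))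
    (fromEquivalence (f-strictMono ∘ <ᵇ⇒< a b) (<⇒<ᵇ ∘ strictMono-reflects-<))

  strictMono-≡ᵇ : ∀ a b → (f a ≡ᵇ f b) ≡ (a ≡ᵇ b)
  strictMono-≡ᵇ a b = det (≡ᵇ-reflects-≡ (f a) (f b))
    (fromEquivalence (cong f ∘ ≡ᵇ⇒≡ a b) (≡⇒≡ᵇ a b ∘ strictMono-injective))

punchIn : ℕ → ℕ → ℕ
punchIn p q = if q <ᵇ p then q else suc q

punchIn-< : ∀ {p q} → q < p → punchIn p q ≡ q
punchIn-< q<p rewrite <ᵇ-true q<p = refl

punchIn-≥ : ∀ {p q} → p ≤ q → punchIn p q ≡ suc q
punchIn-≥ p≤q rewrite <ᵇ-false p≤q = refl

punchIn-strictMono : ∀ p {a b} → a < b → punchIn p a < punchIn p b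
punchIn-strictMono p {a} {b} a<b with a <ᵇ p | <ᵇ-reflects-< a p | b <ᵇ p | <ᵇ-reflects-< b p
... | true  | _        | true  | _      = a<b
... | true  | _        | false | _      = m<n⇒m<1+n a<b
... | false | ofⁿ a≮p  | true  | ofʸ b<p = ⊥-elim (a≮p (<-trans a<b b<p))
... | false | _        | false | _      = s<s a<b

punchIn-≢ : ∀ p q → punchIn p q ≢ p
punchIn-≢ p q with q <? p
... | yes q<p rewrite punchIn-< q<p = <⇒≢ q<p
... | no  q≮p rewrite punchIn-≥ (≮⇒≥ q≮p) = ≢-sym (<⇒≢ (s≤s (≮⇒≥ q≮p)))

punchIn-<ᵇ : ∀ p q → (punchIn p q <ᵇ p) ≡ (q <ᵇ p)
punchIn-<ᵇ p q with q <? p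
... | yes q<p rewrite punchIn-< q<p = refl
... | no  q≮p rewrite punchIn-≥ (≮⇒≥ q≮p) | <ᵇ-false (≮⇒≥ q≮p) = <ᵇ-false (m≤n⇒m≤1+n (≮⇒≥ q≮p))

<ᵇ-punchIn : ∀ p q → (p <ᵇ punchIn p q) ≡ (p <ᵇ q) ∨ (q ≡ᵇ p)
<ᵇ-punchIn p q with <-cmp q p
... | tri< q<p _ _ rewrite punchIn-< q<p | <ᵇ-false (<⇒≤ q<p) | ≡ᵇ-false (<⇒≢ q<p) = refl
... | tri≈ _ refl _ rewrite punchIn-≥ (≤-refl {p}) | <ᵇ-true (n<1+n p) | <ᵇ-false (≤-refl {p}) | ≡ᵇ-refl p = refl
... | tri> _ _ p<q rewrite punchIn-≥ (<⇒≤ p<q) | <ᵇ-true (m<n⇒m<1+n p<q) | <ᵇ-true p<q = refl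

punchInL : ℕ → Letter → Letter
punchInL p = map₁ (punchIn p)

avoidsᵇ : ℕ → Letter → Bool
avoidsᵇ p y = not (proj₁ y ≡ᵇ p)

punchInL-≺ᵇ : ∀ p y z → (punchInL p y ≺ᵇ punchInL p z) ≡ (y ≺ᵇ z)
punchInL-≺ᵇ p (a , c) (b , d) = cong (λ t → (d <ᵇ c) ∨ ((c ≡ᵇ d) ∧ t)) (strictMono-<ᵇ (punchIn-strictMono p) a b)

-- The Boolean argument of lastStepᵇ and predecessorᵇ says whether the alternating word ending in x
-- has even length: lastStepᵇ is the comparison its last two letters y, x must satisfy, and
-- predecessorᵇ the condition the recursion imposes on the standardized letter y.
lastStepᵇ : Bool → Letter → Letter → Bool
lastStepᵇ true  y x = y ≺ᵇ x
lastStepᵇ false y x = x ≺ᵇ y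

predecessorᵇ : Bool → Letter → Letter → Bool
predecessorᵇ true  x y = y ≺ᵇ x
predecessorᵇ false x y = y ⪰ᵇ x

lastStepᵇ-punchInL : ∀ b p c y → lastStepᵇ b (punchInL p y) (p , c) ≡ predecessorᵇ b (p , c) y
lastStepᵇ-punchInL true  p c (q , d) = cong (λ t → (c <ᵇ d) ∨ ((d ≡ᵇ c) ∧ t)) (punchIn-<ᵇ p q)
lastStepᵇ-punchInL false p c (q , d) = begin
  (d <ᵇ c) ∨ ((c ≡ᵇ d) ∧ (p <ᵇ punchIn p q))
    ≡⟨ cong (λ t → (d <ᵇ c) ∨ ((c ≡ᵇ d) ∧ t)) (<ᵇ-punchIn p q) ⟩
  (d <ᵇ c) ∨ ((c ≡ᵇ d) ∧ ((p <ᵇ q) ∨ (q ≡ᵇ p)))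
    ≡⟨ cong ((d <ᵇ c) ∨_) (∧-distribˡ-∨ (c ≡ᵇ d) (p <ᵇ q) (q ≡ᵇ p)) ⟩
  (d <ᵇ c) ∨ (((c ≡ᵇ d) ∧ (p <ᵇ q)) ∨ ((c ≡ᵇ d) ∧ (q ≡ᵇ p)))
    ≡⟨ sym (∨-assoc (d <ᵇ c) _ _) ⟩
  ((d <ᵇ c) ∨ ((c ≡ᵇ d) ∧ (p <ᵇ q))) ∨ ((c ≡ᵇ d) ∧ (q ≡ᵇ p))
    ≡⟨ cong (((d <ᵇ c) ∨ ((c ≡ᵇ d) ∧ (p <ᵇ q))) ∨_)
            (trans (∧-comm (c ≡ᵇ d) (q ≡ᵇ p)) (cong ((q ≡ᵇ p) ∧_) (≡ᵇ-sym c d))) ⟩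
  ((d <ᵇ c) ∨ ((c ≡ᵇ d) ∧ (p <ᵇ q))) ∨ ((q ≡ᵇ p) ∧ (d ≡ᵇ c))
    ∎

distinctValues : List Letter → Bool
distinctValues w = distinct (map proj₁ w)

module _ {f : ℕ → ℕ} {p : ℕ}
         (f-≡ᵇ : ∀ a b → (f a ≡ᵇ f b) ≡ (a ≡ᵇ b)) (f-avoids : ∀ a → (f a ≡ᵇ p) ≡ false) where

  memℕ-map-∷ʳ : ∀ a vs → memℕ (f a) (map f vs ∷ʳ p) ≡ memℕ a vs
  memℕ-map-∷ʳ a []       = cong (_∨ false) (f-avoids a)
  memℕ-map-∷ʳ a (b ∷ vs) = cong₂ _∨_ (f-≡ᵇ a b) (memℕ-map-∷ʳ a vs)

  distinct-map-∷ʳ : ∀ vs → distinct (map f vs ∷ʳ p) ≡ distinct vs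
  distinct-map-∷ʳ []       = refl
  distinct-map-∷ʳ (a ∷ vs) = cong₂ (λ m d → not m ∧ d) (memℕ-map-∷ʳ a vs) (distinct-map-∷ʳ vs)

distinctValues-punchInL : ∀ p c w → distinctValues (map (punchInL p) w ∷ʳ (p , c)) ≡ distinctValues w
distinctValues-punchInL p c w = trans (cong distinct (values w))
  (distinct-map-∷ʳ (strictMono-≡ᵇ (punchIn-strictMono p)) (λ a → ≡ᵇ-false (punchIn-≢ p a)) (map proj₁ w))
  where
  values : ∀ w → map proj₁ (map (punchInL p) w ∷ʳ (p , c)) ≡ map (punchIn p) (map proj₁ w) ∷ʳ p
  values []      = refl
  values (y ∷ w) = cong (punchIn p (proj₁ y) ∷_) (values w)

memℕ-values-∷ʳ : ∀ p c (w : List Letter) → memℕ p (map proj₁ (w ∷ʳ (p , c))) ≡ true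
memℕ-values-∷ʳ p c []      rewrite ≡ᵇ-refl p = refl
memℕ-values-∷ʳ p c (y ∷ w) rewrite memℕ-values-∷ʳ p c w = ∨-zeroʳ (p ≡ᵇ proj₁ y)

distinctValues-∷ʳ-repeat : ∀ p c w → all (avoidsᵇ p) w ≡ false → distinctValues (w ∷ʳ (p , c)) ≡ false
distinctValues-∷ʳ-repeat p c []            ()
distinctValues-∷ʳ-repeat p c ((q , d) ∷ w) h with q ≡ᵇ p in q≡ᵇp
... | true  rewrite ≡ᵇ-true⇒≡ q p q≡ᵇp =
  cong (λ m → not m ∧ distinctValues (w ∷ʳ (p , c))) (memℕ-values-∷ʳ p c w)
... | false rewrite distinctValues-∷ʳ-repeat p c w h = ∧-zeroʳ _

row : ℕ → ℕ → List Letter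
row r p = map (p ,_) (zeroTo r)

letters-suc : ∀ n r → letters (suc n) r ≡ letters n r ++ row r (suc n)
letters-suc n r = begin
  concatMap (row r) (oneTo n ∷ʳ suc n)                 ≡⟨ concatMap-++ (row r) (oneTo n) [ suc n ] ⟩
  letters n r ++ (row r (suc n) ++ [])                 ≡⟨ cong (letters n r ++_) (++-identityʳ (row r (suc n))) ⟩
  letters n r ++ row r (suc n)                         ∎

row-values : ∀ r p → All (λ y → proj₁ y ≡ p) (row r p)
row-values r p = map⁺ (All.universal (λ _ → refl) (zeroTo r))

punchInL-row : ∀ {p q} r → p ≤ q → map (punchInL p) (row r q) ≡ row r (suc q)
punchInL-row {p} {q} r p≤q = begin
  map (punchInL p) (map (q ,_) (zeroTo r))  ≡⟨ sym (map-∘ (zeroTo r)) ⟩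
  map (punchIn p q ,_) (zeroTo r)           ≡⟨ cong (λ q′ → map (q′ ,_) (zeroTo r)) (punchIn-≥ p≤q) ⟩
  map (suc q ,_) (zeroTo r)                 ∎

letters-without : ∀ n r p → 1 ≤ p → p ≤ suc n →
                  filterᵇ (avoidsᵇ p) (letters (suc n) r) ≡ map (punchInL p) (letters n r)
letters-without n r p 1≤p p≤1+n with m<1+n⇒m<n∨m≡n (s≤s p≤1+n)
... | inj₂ refl = begin
  filterᵇ (avoidsᵇ p) (letters (suc n) r)
    ≡⟨ cong (filterᵇ (avoidsᵇ p)) (letters-suc n r) ⟩
  filterᵇ (avoidsᵇ p) (letters n r ++ row r p)
    ≡⟨ filterᵇ-++ (avoidsᵇ p) (letters n r) (row r p) ⟩
  filterᵇ (avoidsᵇ p) (letters n r) ++ filterᵇ (avoidsᵇ p) (row r p)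
    ≡⟨ cong₂ _++_ (filterᵇ-all (All.map below-avoids (letters-InRange n r)))
                  (filterᵇ-none (All.map (λ { refl → cong not (≡ᵇ-refl p) }) (row-values r p))) ⟩
  letters n r ++ []
    ≡⟨ ++-identityʳ (letters n r) ⟩
  letters n r
    ≡⟨ sym (map-id-local (All.map below-fixed (letters-InRange n r))) ⟩
  map (punchInL p) (letters n r) ∎
  where
  below-avoids : ∀ {y} → InRange n r y → avoidsᵇ p y ≡ true
  below-avoids ((_ , q≤n) , _) = cong not (≡ᵇ-false (<⇒≢ (s≤s q≤n)))
  below-fixed : ∀ {y} → InRange n r y → punchInL p y ≡ y
  below-fixed ((_ , q≤n) , _) = cong (_, _) (punchIn-< (s≤s q≤n))
letters-without (suc n) r p 1≤p p≤1+n | inj₁ (s≤s p≤n) = begin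
  filterᵇ (avoidsᵇ p) (letters (suc (suc n)) r)
    ≡⟨ cong (filterᵇ (avoidsᵇ p)) (letters-suc (suc n) r) ⟩
  filterᵇ (avoidsᵇ p) (letters (suc n) r ++ row r (suc (suc n)))
    ≡⟨ filterᵇ-++ (avoidsᵇ p) (letters (suc n) r) (row r (suc (suc n))) ⟩
  filterᵇ (avoidsᵇ p) (letters (suc n) r) ++ filterᵇ (avoidsᵇ p) (row r (suc (suc n)))
    ≡⟨ cong₂ _++_ (letters-without n r p 1≤p p≤n)
                  (filterᵇ-all (All.map (λ { refl → cong not (≡ᵇ-false (≢-sym (<⇒≢ (s≤s p≤n)))) }) (row-values r _))) ⟩
  map (punchInL p) (letters n r) ++ row r (suc (suc n))
    ≡⟨ cong (map (punchInL p) (letters n r) ++_) (sym (punchInL-row r p≤n)) ⟩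
  map (punchInL p) (letters n r) ++ map (punchInL p) (row r (suc n))
    ≡⟨ sym (map-++ (punchInL p) (letters n r) (row r (suc n))) ⟩
  map (punchInL p) (letters n r ++ row r (suc n))
    ≡⟨ cong (map (punchInL p)) (sym (letters-suc n r)) ⟩
  map (punchInL p) (letters (suc n) r) ∎
letters-without zero r p 1≤p p≤1+n | inj₁ (s≤s p≤0) = ⊥-elim (<-irrefl refl (≤-trans 1≤p p≤0))

∑-words-suc : ∀ k (L : List Letter) F → ∑ (words (suc k) L) F ≡ ∑[ x ∈ L ] ∑[ w ∈ words k L ] F (x ∷ w)
∑-words-suc k L F =
  trans (∑-concatMap (λ x → map (x ∷_) (words k L)) L F) (∑-cong L (λ x → ∑-map (x ∷_) (words k L) F))

∑-words-∷ʳ : ∀ k (L : List Letter) F → ∑ (words (suc k) L) F ≡ ∑[ u ∈ words k L ] ∑[ z ∈ L ] F (u ∷ʳ z)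
∑-words-∷ʳ zero    L F =
  trans (∑-words-suc zero L F) (trans (∑-cong L (λ z → +-identityʳ (F [ z ]))) (sym (+-identityʳ _)))
∑-words-∷ʳ (suc k) L F = begin
  ∑ (words (suc (suc k)) L) F
    ≡⟨ ∑-words-suc (suc k) L F ⟩
  ∑[ x ∈ L ] ∑[ w ∈ words (suc k) L ] F (x ∷ w)
    ≡⟨ ∑-cong L (λ x → ∑-words-∷ʳ k L (F ∘ (x ∷_))) ⟩
  ∑[ x ∈ L ] ∑[ u ∈ words k L ] ∑[ z ∈ L ] F (x ∷ u ∷ʳ z)
    ≡⟨ sym (∑-words-suc k L (λ u → ∑[ z ∈ L ] F (u ∷ʳ z))) ⟩
  ∑[ u ∈ words (suc k) L ] ∑[ z ∈ L ] F (u ∷ʳ z) ∎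

∑-words-filterᵇ : ∀ k (f : Letter → Bool) L F →
  ∑[ w ∈ words k L ] (if all f w then F w else 0) ≡ ∑ (words k (filterᵇ f L)) F
∑-words-filterᵇ zero    f L F = refl
∑-words-filterᵇ (suc k) f L F = begin
  ∑[ w ∈ words (suc k) L ] (if all f w then F w else 0)
    ≡⟨ ∑-words-suc k L _ ⟩
  ∑[ x ∈ L ] ∑[ w ∈ words k L ] (if f x ∧ all f w then F (x ∷ w) else 0)
    ≡⟨ ∑-cong L head ⟩
  ∑[ x ∈ L ] (if f x then ∑ (words k (filterᵇ f L)) (F ∘ (x ∷_)) else 0)
    ≡⟨ sym (∑-filterᵇ f L _) ⟩
  ∑[ x ∈ filterᵇ f L ] ∑ (words k (filterᵇ f L)) (F ∘ (x ∷_))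
    ≡⟨ sym (∑-words-suc k (filterᵇ f L) F) ⟩
  ∑ (words (suc k) (filterᵇ f L)) F ∎
  where
  head : ∀ x → ∑[ w ∈ words k L ] (if f x ∧ all f w then F (x ∷ w) else 0)
             ≡ (if f x then ∑ (words k (filterᵇ f L)) (F ∘ (x ∷_)) else 0)
  head x with f x
  ... | true  = ∑-words-filterᵇ k f L (F ∘ (x ∷_))
  ... | false = ∑-zero (words k L)

words-map : ∀ k (g : Letter → Letter) L → words k (map g L) ≡ map (map g) (words k L)
words-map zero    g L = refl
words-map (suc k) g L = begin
  concatMap (λ x → map (x ∷_) (words k (map g L))) (map g L)
    ≡⟨ concatMap-map _ g L ⟩
  concatMap (λ y → map (g y ∷_) (words k (map g L))) L
    ≡⟨ concatMap-cong (λ y → cong (map (g y ∷_)) (words-map k g L)) L ⟩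
  concatMap (λ y → map (g y ∷_) (map (map g) (words k L))) L
    ≡⟨ concatMap-cong (λ y → trans (sym (map-∘ (words k L))) (map-∘ (words k L))) L ⟩
  concatMap (λ y → map (map g) (map (y ∷_) (words k L))) L
    ≡⟨ sym (map-concatMap (map g) _ L) ⟩
  map (map g) (concatMap (λ y → map (y ∷_) (words k L)) L) ∎

words-length : ∀ k (L : List Letter) → All (λ w → length w ≡ k) (words k L)
words-length zero    L = refl ∷ []
words-length (suc k) L = concat⁺ (map⁺ (All.universal (λ x → map⁺ (All.map (cong suc) (words-length k L))) L))

words-All : ∀ {P : Letter → Set} k {L} → All P L → All (All P) (words k L)
words-All zero    pL = [] ∷ []
words-All (suc k) pL = concat⁺ (map⁺ (All.map (λ px → map⁺ (All.map (px ∷_) (words-All k pL))) pL))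

evenᵇ : ℕ → Bool
evenᵇ zero          = true
evenᵇ (suc zero)    = false
evenᵇ (suc (suc n)) = evenᵇ n

evenᵇ≡%2≡ᵇ0 : ∀ n → evenᵇ n ≡ (n % 2 ≡ᵇ 0)
evenᵇ≡%2≡ᵇ0 zero          = refl
evenᵇ≡%2≡ᵇ0 (suc zero)    = refl
evenᵇ≡%2≡ᵇ0 (suc (suc n)) = evenᵇ≡%2≡ᵇ0 n

lastOf : A → List A → A
lastOf y []      = y
lastOf y (z ∷ u) = lastOf z u

lastOf-map : ∀ (f : A → B) y u → lastOf (f y) (map f u) ≡ f (lastOf y u)
lastOf-map f y []      = refl
lastOf-map f y (z ∷ u) = lastOf-map f z u

All-lastOf : ∀ {P : A → Set} {y u} → All P (y ∷ u) → P (lastOf y u)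
All-lastOf (py ∷ [])      = py
All-lastOf (_  ∷ pz ∷ pu) = All-lastOf (pz ∷ pu)

endsWith-∷ : ∀ x y u → endsWith x (y ∷ u) ≡ (lastOf y u ==ᵇ x)
endsWith-∷ x y []      = refl
endsWith-∷ x y (z ∷ u) = endsWith-∷ x z u

endsWith-∷ʳ : ∀ x u z → endsWith x (u ∷ʳ z) ≡ (z ==ᵇ x)
endsWith-∷ʳ x []           z = refl
endsWith-∷ʳ x (y ∷ [])     z = refl
endsWith-∷ʳ x (y ∷ y′ ∷ u) z = endsWith-∷ʳ x (y′ ∷ u) z

altUp-∷ʳ   : ∀ y u x →
  altUp (y ∷ u ∷ʳ x) ≡ altUp (y ∷ u) ∧ lastStepᵇ (evenᵇ (length u)) (lastOf y u) x
altDown-∷ʳ : ∀ y u x →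
  altDown (y ∷ u ∷ʳ x) ≡ altDown (y ∷ u) ∧ lastStepᵇ (evenᵇ (suc (length u))) (lastOf y u) x
altUp-∷ʳ   y []      x = ∧-identityʳ (y ≺ᵇ x)
altUp-∷ʳ   y (z ∷ u) x = trans (cong ((y ≺ᵇ z) ∧_) (altDown-∷ʳ z u x)) (sym (∧-assoc (y ≺ᵇ z) _ _))
altDown-∷ʳ y []      x = ∧-identityʳ (x ≺ᵇ y)
altDown-∷ʳ y (z ∷ u) x = trans (cong ((z ≺ᵇ y) ∧_) (altUp-∷ʳ z u x)) (sym (∧-assoc (z ≺ᵇ y) _ _))

module _ {f : Letter → Letter} (f-≺ᵇ : ∀ y z → (f y ≺ᵇ f z) ≡ (y ≺ᵇ z)) where

  altUp-map   : ∀ u → altUp (map f u) ≡ altUp u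
  altDown-map : ∀ u → altDown (map f u) ≡ altDown u
  altUp-map   []          = refl
  altUp-map   (y ∷ [])     = refl
  altUp-map   (y ∷ z ∷ u) = cong₂ _∧_ (f-≺ᵇ y z) (altDown-map (z ∷ u))
  altDown-map []          = refl
  altDown-map (y ∷ [])     = refl
  altDown-map (y ∷ z ∷ u) = cong₂ _∧_ (f-≺ᵇ z y) (altUp-map (z ∷ u))

-- Counting alternating colored permutations

isAltPermᵇ : List Letter → Bool
isAltPermᵇ w = distinctValues w ∧ altUp w

N-as-sum : ∀ r n x → N r n x ≡ ∑[ w ∈ words n (letters n r) ] ⟦ isAltPermᵇ w ∧ endsWith x w ⟧
N-as-sum r n x = begin
  length (filterᵇ (λ w → altUp w ∧ endsWith x w) (filterᵇ distinctValues W))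
    ≡⟨ cong length (filterᵇ-filterᵇ (λ w → altUp w ∧ endsWith x w) distinctValues W) ⟩
  length (filterᵇ (λ w → distinctValues w ∧ (altUp w ∧ endsWith x w)) W)
    ≡⟨ length-filterᵇ _ W ⟩
  ∑[ w ∈ W ] ⟦ distinctValues w ∧ (altUp w ∧ endsWith x w) ⟧
    ≡⟨ ∑-cong W (λ w → cong ⟦_⟧ (sym (∧-assoc (distinctValues w) _ _))) ⟩
  ∑[ w ∈ W ] ⟦ isAltPermᵇ w ∧ endsWith x w ⟧ ∎
  where W = words n (letters n r)

N-by-last-letter : ∀ m r x → InRange (suc m) r x →
  N r (suc m) x ≡ ∑[ u ∈ words m (letters (suc m) r) ] ⟦ isAltPermᵇ (u ∷ʳ x) ⟧
N-by-last-letter m r x x∈ = begin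
  N r (suc m) x
    ≡⟨ N-as-sum r (suc m) x ⟩
  ∑[ w ∈ words (suc m) L ] ⟦ isAltPermᵇ w ∧ endsWith x w ⟧
    ≡⟨ ∑-words-∷ʳ m L _ ⟩
  ∑[ u ∈ words m L ] ∑[ z ∈ L ] ⟦ isAltPermᵇ (u ∷ʳ z) ∧ endsWith x (u ∷ʳ z) ⟧
    ≡⟨ ∑-cong (words m L) (λ u → trans (∑-cong L (ends-in u)) (∑-letters-δ (λ z → ⟦ isAltPermᵇ (u ∷ʳ z) ⟧) x∈)) ⟩
  ∑[ u ∈ words m L ] ⟦ isAltPermᵇ (u ∷ʳ x) ⟧ ∎
  where
  L = letters (suc m) r
  ends-in : ∀ u z → ⟦ isAltPermᵇ (u ∷ʳ z) ∧ endsWith x (u ∷ʳ z) ⟧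
                  ≡ (if z ==ᵇ x then ⟦ isAltPermᵇ (u ∷ʳ z) ⟧ else 0)
  ends-in u z = trans (cong (λ b → ⟦ isAltPermᵇ (u ∷ʳ z) ∧ b ⟧) (endsWith-∷ʳ x u z))
                      (⟦∧⟧ (isAltPermᵇ (u ∷ʳ z)) (z ==ᵇ x))

∑-filterᵇ-letters-δ : ∀ {n r z} (κ : Letter → Bool) b → InRange n r z →
  ∑[ y ∈ filterᵇ κ (letters n r) ] ⟦ b ∧ (z ==ᵇ y) ⟧ ≡ ⟦ b ∧ κ z ⟧
∑-filterᵇ-letters-δ {n} {r} {z} κ b z∈ = begin
  ∑[ y ∈ filterᵇ κ L ] ⟦ b ∧ (z ==ᵇ y) ⟧                         ≡⟨ ∑-filterᵇ κ L _ ⟩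
  ∑[ y ∈ L ] (if κ y then ⟦ b ∧ (z ==ᵇ y) ⟧ else 0)              ≡⟨ ∑-cong L select ⟩
  ∑[ y ∈ L ] (if y ==ᵇ z then (if κ y then ⟦ b ⟧ else 0) else 0) ≡⟨ ∑-letters-δ (λ y → if κ y then ⟦ b ⟧ else 0) z∈ ⟩
  (if κ z then ⟦ b ⟧ else 0)                                    ≡⟨ sym (⟦∧⟧ b (κ z)) ⟩
  ⟦ b ∧ κ z ⟧                                                   ∎
  where
  L = letters n r
  select : ∀ y → (if κ y then ⟦ b ∧ (z ==ᵇ y) ⟧ else 0) ≡ (if y ==ᵇ z then (if κ y then ⟦ b ⟧ else 0) else 0)
  select y rewrite ⟦∧⟧ b (z ==ᵇ y) | ==ᵇ-sym z y = if-swap (κ y) (y ==ᵇ z) ⟦ b ⟧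

∑-by-lastOf : ∀ m r (κ : Letter → Bool) →
  ∑[ v ∈ letters (suc m) r ] ∑[ u ∈ words m (letters (suc m) r) ] ⟦ isAltPermᵇ (v ∷ u) ∧ κ (lastOf v u) ⟧
    ≡ ∑[ y ∈ filterᵇ κ (letters (suc m) r) ] N r (suc m) y
∑-by-lastOf m r κ = begin
  ∑[ v ∈ L ] ∑[ u ∈ words m L ] ⟦ isAltPermᵇ (v ∷ u) ∧ κ (lastOf v u) ⟧
    ≡⟨ ∑-cong-All (letters-InRange (suc m) r) (λ v∈ → ∑-cong-All (words-All m (letters-InRange (suc m) r))
                                                               (last-letter v∈)) ⟩
  ∑[ v ∈ L ] ∑[ u ∈ words m L ] ∑[ y ∈ F ] ⟦ isAltPermᵇ (v ∷ u) ∧ endsWith y (v ∷ u) ⟧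
    ≡⟨ sym (∑-words-suc m L _) ⟩
  ∑[ w ∈ words (suc m) L ] ∑[ y ∈ F ] ⟦ isAltPermᵇ w ∧ endsWith y w ⟧
    ≡⟨ ∑-comm (words (suc m) L) F _ ⟩
  ∑[ y ∈ F ] ∑[ w ∈ words (suc m) L ] ⟦ isAltPermᵇ w ∧ endsWith y w ⟧
    ≡⟨ sym (∑-cong F (N-as-sum r (suc m))) ⟩
  ∑[ y ∈ F ] N r (suc m) y ∎
  where
  L = letters (suc m) r
  F = filterᵇ κ L
  last-letter : ∀ {v u} → InRange (suc m) r v → All (InRange (suc m) r) u →
    ⟦ isAltPermᵇ (v ∷ u) ∧ κ (lastOf v u) ⟧ ≡ ∑[ y ∈ F ] ⟦ isAltPermᵇ (v ∷ u) ∧ endsWith y (v ∷ u) ⟧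
  last-letter {v} {u} v∈ u∈ = sym (begin
    ∑[ y ∈ F ] ⟦ isAltPermᵇ (v ∷ u) ∧ endsWith y (v ∷ u) ⟧
      ≡⟨ ∑-cong F (λ y → cong (λ e → ⟦ isAltPermᵇ (v ∷ u) ∧ e ⟧) (endsWith-∷ y v u)) ⟩
    ∑[ y ∈ F ] ⟦ isAltPermᵇ (v ∷ u) ∧ (lastOf v u ==ᵇ y) ⟧
      ≡⟨ ∑-filterᵇ-letters-δ κ (isAltPermᵇ (v ∷ u)) (All-lastOf (v∈ ∷ u∈)) ⟩
    ⟦ isAltPermᵇ (v ∷ u) ∧ κ (lastOf v u) ⟧ ∎)

isAltPermᵇ-punchInL : ∀ p c v u →
  isAltPermᵇ (punchInL p v ∷ map (punchInL p) u ∷ʳ (p , c))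
    ≡ isAltPermᵇ (v ∷ u) ∧ predecessorᵇ (evenᵇ (length u)) (p , c) (lastOf v u)
isAltPermᵇ-punchInL p c v u = begin
  distinctValues (map g (v ∷ u) ∷ʳ x) ∧ altUp (g v ∷ map g u ∷ʳ x)
    ≡⟨ cong₂ _∧_ (distinctValues-punchInL p c (v ∷ u)) (altUp-∷ʳ (g v) (map g u) x) ⟩
  distinctValues (v ∷ u) ∧ (altUp (map g (v ∷ u)) ∧ lastStepᵇ (evenᵇ (length (map g u))) (lastOf (g v) (map g u)) x)
    ≡⟨ cong (distinctValues (v ∷ u) ∧_) (cong₂ _∧_ (altUp-map (punchInL-≺ᵇ p) (v ∷ u)) last-step) ⟩
  distinctValues (v ∷ u) ∧ (altUp (v ∷ u) ∧ predecessorᵇ (evenᵇ (length u)) x (lastOf v u))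
    ≡⟨ sym (∧-assoc (distinctValues (v ∷ u)) _ _) ⟩
  isAltPermᵇ (v ∷ u) ∧ predecessorᵇ (evenᵇ (length u)) x (lastOf v u) ∎
  where
  g = punchInL p
  x = (p , c)
  last-step : lastStepᵇ (evenᵇ (length (map g u))) (lastOf (g v) (map g u)) x
            ≡ predecessorᵇ (evenᵇ (length u)) x (lastOf v u)
  last-step rewrite length-map g u | lastOf-map g v u = lastStepᵇ-punchInL (evenᵇ (length u)) p c (lastOf v u)

N-recurrence : ∀ r m p c → 1 ≤ p → p ≤ suc (suc m) → c < r →
  N r (suc (suc m)) (p , c) ≡ ∑[ y ∈ filterᵇ (predecessorᵇ (evenᵇ m) (p , c)) (letters (suc m) r) ] N r (suc m) y
N-recurrence r m p c 1≤p p≤n c<r = begin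
  N r (suc (suc m)) x
    ≡⟨ N-by-last-letter (suc m) r x ((1≤p , p≤n) , c<r) ⟩
  ∑[ u ∈ words (suc m) Lₙ ] ⟦ isAltPermᵇ (u ∷ʳ x) ⟧
    ≡⟨ ∑-cong (words (suc m) Lₙ) avoids-p ⟩
  ∑[ u ∈ words (suc m) Lₙ ] (if all (avoidsᵇ p) u then ⟦ isAltPermᵇ (u ∷ʳ x) ⟧ else 0)
    ≡⟨ ∑-words-filterᵇ (suc m) (avoidsᵇ p) Lₙ _ ⟩
  ∑[ u ∈ words (suc m) (filterᵇ (avoidsᵇ p) Lₙ) ] ⟦ isAltPermᵇ (u ∷ʳ x) ⟧
    ≡⟨ cong (λ L → ∑[ u ∈ words (suc m) L ] ⟦ isAltPermᵇ (u ∷ʳ x) ⟧) (letters-without (suc m) r p 1≤p p≤n) ⟩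
  ∑[ u ∈ words (suc m) (map g Lₘ) ] ⟦ isAltPermᵇ (u ∷ʳ x) ⟧
    ≡⟨ cong (λ W → ∑[ u ∈ W ] ⟦ isAltPermᵇ (u ∷ʳ x) ⟧) (words-map (suc m) g Lₘ) ⟩
  ∑[ u ∈ map (map g) (words (suc m) Lₘ) ] ⟦ isAltPermᵇ (u ∷ʳ x) ⟧
    ≡⟨ ∑-map (map g) (words (suc m) Lₘ) _ ⟩
  ∑[ u ∈ words (suc m) Lₘ ] ⟦ isAltPermᵇ (map g u ∷ʳ x) ⟧
    ≡⟨ ∑-words-suc m Lₘ _ ⟩
  ∑[ v ∈ Lₘ ] ∑[ u ∈ words m Lₘ ] ⟦ isAltPermᵇ (g v ∷ map g u ∷ʳ x) ⟧
    ≡⟨ ∑-cong Lₘ (λ v → ∑-cong-All (words-length m Lₘ) (λ {u} → standardize v u)) ⟩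
  ∑[ v ∈ Lₘ ] ∑[ u ∈ words m Lₘ ] ⟦ isAltPermᵇ (v ∷ u) ∧ predecessorᵇ (evenᵇ m) x (lastOf v u) ⟧
    ≡⟨ ∑-by-lastOf m r (predecessorᵇ (evenᵇ m) x) ⟩
  ∑[ y ∈ filterᵇ (predecessorᵇ (evenᵇ m) x) Lₘ ] N r (suc m) y ∎
  where
  x  = (p , c)
  g  = punchInL p
  Lₙ = letters (suc (suc m)) r
  Lₘ = letters (suc m) r
  standardize : ∀ v u → length u ≡ m → ⟦ isAltPermᵇ (g v ∷ map g u ∷ʳ x) ⟧
                                      ≡ ⟦ isAltPermᵇ (v ∷ u) ∧ predecessorᵇ (evenᵇ m) x (lastOf v u) ⟧
  standardize v u refl = cong ⟦_⟧ (isAltPermᵇ-punchInL p c v u)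
  avoids-p : ∀ u → ⟦ isAltPermᵇ (u ∷ʳ x) ⟧ ≡ (if all (avoidsᵇ p) u then ⟦ isAltPermᵇ (u ∷ʳ x) ⟧ else 0)
  avoids-p u with all (avoidsᵇ p) u in h
  ... | true  = refl
  ... | false rewrite distinctValues-∷ʳ-repeat p c u h = refl

proposition8p1 : (r : ℕ) → 1 ≤ r →
    ((c : ℕ) → c < r → N r 1 (1 , c) ≡ 1)
    × ((n : ℕ) → 2 ≤ n → (p c : ℕ) → 1 ≤ p → p ≤ n → c < r →
        (n % 2 ≡ 0 → N r n (p , c)
            ≡ sum (map (N r (n ∸ 1)) (filterᵇ (λ y → y ≺ᵇ (p , c)) (letters (n ∸ 1) r))))
        × (n % 2 ≡ 1 → N r n (p , c)
            ≡ sum (map (N r (n ∸ 1)) (filterᵇ (λ y → y ⪰ᵇ (p , c)) (letters (n ∸ 1) r)))))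
proposition8p1 r _ =
  (λ c c<r → N-by-last-letter 0 r (1 , c) ((s≤s z≤n , s≤s z≤n) , c<r)) ,
  λ { (suc (suc m)) _ p c 1≤p p≤n c<r →
        let recurrence = N-recurrence r m p c 1≤p p≤n c<r
            parity : ∀ {b} → m % 2 ≡ b → evenᵇ m ≡ (b ≡ᵇ 0)
            parity m%2≡b = trans (evenᵇ≡%2≡ᵇ0 m) (cong (_≡ᵇ 0) m%2≡b)
            sum-over : Bool → ℕ
            sum-over e = ∑ (filterᵇ (predecessorᵇ e (p , c)) (letters (suc m) r)) (N r (suc m))
        in (λ even → trans recurrence (cong sum-over (parity even)))
         , (λ odd  → trans recurrence (cong sum-over (parity odd)))
    ; (suc zero) (s≤s ()) }
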